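{- Let $T$ be a text and $\mathcal{D}$ a dictionary of nonempty patterns such that no $P\in\mathcal{D}$ is highly periodic. Let $F_1,F_2,F_3$ be three consecutive fragments of $T$ with $|F_1|=|F_3|$ and $|F_2|\ge 8|F_1|$. Then $$\textsc{3-Fragments-Counting}(F_1,F_2,F_3)=\textsc{Count}(F_1F_2F_3)-\textsc{Count}(F_1F_2)-\textsc{Count}(F_2F_3)+\textsc{Count}(F_2).$$
   Context: Fragments $T[i_1\mathinner{.\,.} j_1]$ and $T[i_2\mathinner{.\,.} j_2]$ are consecutive if $i_2=j_1+1$; $F_1F_2$ etc. denote the fragment formed by concatenating consecutive fragments. The period $\textsf{per}(S)$ of a string $S$ is its smallest positive $p$ with $S[t]=S[t+p]$ for all valid $t$; $S$ is highly periodic if $\textsf{per}(S)\le |S|/4$. For a fragment $F$ of $T$, $\textsc{Count}(F)$ is the total number of occurrences of patterns of $\mathcal{D}$ contained in $F$ (i.e., the number of pairs $(P, [a,b])$ with $P\in\mathcal{D}$, $T[a\mathinner{.\,.} b]=P$ and $[a,b]$ within $F$). $\textsc{3-Fragments-Counting}(F_1,F_2,F_3)$ is the number of distinct patterns $P\in\mathcal{D}$ that have an occurrence starting in $F_1$ and ending in $F_3$ and that occur neither in $F_1F_2$ nor in $F_2F_3$. -}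

module Defs where

open import Data.Nat using (ℕ; zero; suc; _+_; _*_; _∸_; _≤_; _<_)
open import Data.Nat.Properties using (_≤?_; _<?_)
open import Data.List using (List; []; _∷_; length; take; drop; filter; map; upTo)
open import Data.Nat.ListAction using (sum)
open import Data.List.Relation.Unary.Any using (Any; any?)
open import Data.Maybe using (Maybe; just; nothing)
open import Data.Product using (Σ; _×_; ∃)
open import Relation.Binary.Definitions using (DecidableEquality)
open import Relation.Binary.PropositionalEquality using (_≡_)
open import Relation.Nullary using (¬_; Dec; yes; no)
open import Relation.Nullary.Decidable using (_×-dec_; ¬?)
open import Data.List.Properties using (≡-dec)

-- Strings over an alphabet A are lists; positions are 0-indexed.

_!!_ : ∀ {A : Set} → List A → ℕ → Maybe A
[]      !! _     = nothing
(x ∷ _) !! zero  = just x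
(_ ∷ s) !! suc t = s !! t

IsPeriod : ∀ {A : Set} → List A → ℕ → Set
IsPeriod S p = (0 < p) × (∀ t → t + p < length S → S !! t ≡ S !! (t + p))

IsPer : ∀ {A : Set} → List A → ℕ → Set
IsPer S p = IsPeriod S p × (∀ q → IsPeriod S q → p ≤ q)

-- highly periodic : per(S) ≤ |S|/4   (i.e. 4 * per(S) ≤ |S| for natural numbers)
HighlyPeriodic : ∀ {A : Set} → List A → Set
HighlyPeriodic S = Σ ℕ λ p → IsPer S p × (4 * p ≤ length S)

module _ {A : Set} (_≟_ : DecidableEquality A) where

  OccursAt : List A → List A → ℕ → Set
  OccursAt T P a = (a + length P ≤ length T) × (take (length P) (drop a T) ≡ P)

  occursAt? : ∀ T P a → Dec (OccursAt T P a)
  occursAt? T P a = (a + length P ≤? length T) ×-dec ≡-dec _≟_ (take (length P) (drop a T)) P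

  range : ℕ → ℕ → List ℕ
  range i l = map (i +_) (upTo (l ∸ i))

  -- occurrence of P at a contained in the fragment T[i .. l-1]  (half-open [i, l))
  OccIn : List A → List A → ℕ → ℕ → ℕ → Set
  OccIn T P i l a = OccursAt T P a × (a + length P ≤ l)

  occIn? : ∀ T P i l a → Dec (OccIn T P i l a)
  occIn? T P i l a = occursAt? T P a ×-dec (a + length P ≤? l)

  Count : List (List A) → List A → ℕ → ℕ → ℕ
  Count D T i l = sum (map (λ P → length (filter (occIn? T P i l) (range i l))) D)

  OccursInFrag : List A → List A → ℕ → ℕ → Set
  OccursInFrag T P i l = Any (OccIn T P i l) (range i l)

  -- P has an occurrence starting in T[i .. j-1] and ending (last position) in T[k .. l-1]
  StartEnd : List A → List A → ℕ → ℕ → ℕ → ℕ → Set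
  StartEnd T P i j k l = Any (λ a → OccIn T P i l a × (k < a + length P)) (range i j)

  -- the property counted by 3-Fragments-Counting for F1 = [i,j), F2 = [j,k), F3 = [k,l)
  ThreeFrag : List A → ℕ → ℕ → ℕ → ℕ → List A → Set
  ThreeFrag T i j k l P =
    StartEnd T P i j k l × (¬ OccursInFrag T P i k) × (¬ OccursInFrag T P j l)

  threeFrag? : ∀ T i j k l P → Dec (ThreeFrag T i j k l P)
  threeFrag? T i j k l P =
    any? (λ a → occIn? T P i l a ×-dec (k <? a + length P)) (range i j)
    ×-dec ¬? (any? (occIn? T P i k) (range i k))
    ×-dec ¬? (any? (occIn? T P j l) (range j l))

  -- 3-Fragments-Counting(F1,F2,F3): number of distinct patterns of D (D is a duplicate-free list)
  ThreeFragmentsCounting : List (List A) → List A → ℕ → ℕ → ℕ → ℕ → ℕ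
  ThreeFragmentsCounting D T i j k l = length (filter (threeFrag? T i j k l) D)

module Submission where

-- Fix a pattern P and let c(x,y) be the number of occurrences of P inside
-- T[x .. y).  Splitting occurrences by whether they start in F₁ = [i,j), and
-- those that do by whether they end inside F₁F₂ or reach into F₃ ("spanning"
-- occurrences), gives, for every P,
--     c(i,l) + c(j,k) = c(i,k) + c(j,l) + s(P),      s(P) = #spanning occurrences.
-- A spanning occurrence is longer than F₂, so |P| > 8|F₁|.  Two occurrences of P
-- at distance 0 < d make d a period of P, and if d < |F₁| then 4d ≤ |P|, so a
-- pattern that is not highly periodic has no two occurrences that close.  Hence
-- there is at most one spanning occurrence, and a spanning occurrence rules out
-- every occurrence inside F₁F₂ and inside F₂F₃: s(P) is 1 exactly when P is
-- counted by 3-Fragments-Counting and 0 otherwise.  Summing over the dictionary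
-- and rearranging in ℤ gives the theorem.

open import Defs
open import Data.Nat using (ℕ; zero; suc; _+_; _*_; _∸_; _≤_; _<_; z≤n; s≤s)
open import Data.Nat.Properties
open import Data.Nat.Tactic.RingSolver using (solve-∀)
open import Data.Integer using (ℤ; +_) renaming (_+_ to _+ℤ_; _-_ to _-ℤ_)
open import Data.Integer.Properties using (pos-+)
import Data.Integer.Tactic.RingSolver as ℤ-Solver
open import Data.List using (List; []; _∷_; [_]; length; filter; map; upTo; applyUpTo; _++_; take; drop)
open import Data.List.Properties using (filter-++; length-++; filter-accept; filter-reject; filter-none; filter-≐; map-upTo; map-cong; map-∘)
open import Data.List.Membership.Propositional using (_∈_; find)
open import Data.List.Membership.Propositional.Properties using (∈-map⁺; ∈-map⁻; ∈-upTo⁺; ∈-upTo⁻)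
open import Data.List.Relation.Unary.All as All using (All; []; _∷_; all?)
open import Data.List.Relation.Unary.All.Properties using (¬Any⇒All¬)
open import Data.List.Relation.Unary.Any as Any using (Any; here; there)
open import Data.List.Relation.Unary.Unique.Propositional using (Unique; _∷_)
import Data.List.Relation.Unary.Unique.Propositional.Properties as Unique
open import Data.Maybe.Properties using () renaming (≡-dec to maybe-≡-dec)
open import Data.Product using (Σ; _×_; _,_; proj₁)
open import Data.Sum using (inj₁; inj₂)
open import Data.Empty using (⊥; ⊥-elim)
open import Function using (_∘_)
open import Relation.Unary using (Decidable)
open import Relation.Unary.Properties using (_∩?_; ∁?)
open import Relation.Binary.Definitions using (DecidableEquality; tri<; tri≈; tri>)
open import Relation.Binary.PropositionalEquality using (_≡_; _≢_; refl; sym; trans; cong; cong₂; subst; module ≡-Reasoning)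
open import Relation.Nullary using (¬_; Dec; yes; no)
open import Relation.Nullary.Decidable using (_×-dec_; _→-dec_; map′)

module _ {X : Set} {Q : X → Set} (Q? : Decidable Q) where

  count : List X → ℕ
  count xs = length (filter Q? xs)

  count-++ : ∀ xs ys → count (xs ++ ys) ≡ count xs + count ys
  count-++ xs ys = trans (cong length (filter-++ Q? xs ys)) (length-++ (filter Q? xs))

  count-partition : {R : X → Set} (R? : Decidable R) → ∀ xs →
    count xs ≡ length (filter (Q? ∩? R?) xs) + length (filter (Q? ∩? ∁? R?) xs)
  count-partition R? [] = refl
  count-partition R? (x ∷ xs) with Q? x | R? x
  ... | yes _ | yes _ = cong suc (count-partition R? xs)
  ... | yes _ | no _  = trans (cong suc (count-partition R? xs)) (sym (+-suc _ _))
  ... | no _  | _     = count-partition R? xs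

  count-single : ∀ {xs} → Unique xs → (∀ {x y} → x ∈ xs → y ∈ xs → Q x → Q y → x ≡ y) →
    Any Q xs → count xs ≡ 1
  count-single {x ∷ xs} (x∉xs ∷ _) same _ with Q? x
  ... | yes qx = cong (suc ∘ length) (filter-none Q? (All.tabulate λ y∈xs qy →
                   All.lookup x∉xs y∈xs (same (here refl) (there y∈xs) qx qy)))
  count-single {x ∷ xs} (_ ∷ unique) same anyQ | no ¬qx =
    count-single unique (λ x∈ y∈ → same (there x∈) (there y∈)) (Any.tail ¬qx anyQ)

window-distance : ∀ {i x y j} → i ≤ x → x ≤ y → y < j → y ∸ x < j ∸ i
window-distance i≤x x≤y y<j = ≤-<-trans (∸-monoʳ-≤ _ i≤x) (∸-monoˡ-< y<j (≤-trans i≤x x≤y))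

gap-bound : ∀ {a b k l} L → a ≤ b → k < a + L → b + L ≤ l → b ∸ a < l ∸ k
gap-bound {a} {b} {k} {l} L a≤b k<a+L b+L≤l = m+n≤o⇒m≤o∸n (suc (b ∸ a)) (begin
  suc (b ∸ a) + k     ≡⟨ sym (+-suc (b ∸ a) k) ⟩
  b ∸ a + suc k       ≤⟨ +-monoʳ-≤ (b ∸ a) k<a+L ⟩
  b ∸ a + (a + L)     ≡⟨ sym (+-assoc (b ∸ a) a L) ⟩
  b ∸ a + a + L       ≡⟨ cong (_+ L) (m∸n+n≡m a≤b) ⟩
  b + L               ≤⟨ b+L≤l ⟩
  l                   ∎)
  where open ≤-Reasoning

add-identities : ∀ a b c d s a′ b′ c′ d′ s′ →
  a + b ≡ c + d + s → a′ + b′ ≡ c′ + d′ + s′ →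
  (a + a′) + (b + b′) ≡ (c + c′) + (d + d′) + (s + s′)
add-identities a b c d s a′ b′ c′ d′ s′ e e′ = begin
  (a + a′) + (b + b′)               ≡⟨ regroup a a′ b b′ ⟩
  (a + b) + (a′ + b′)               ≡⟨ cong₂ _+_ e e′ ⟩
  (c + d + s) + (c′ + d′ + s′)      ≡⟨ regroup′ c d s c′ d′ s′ ⟩
  (c + c′) + (d + d′) + (s + s′)    ∎
  where
  open ≡-Reasoning
  regroup : ∀ a a′ b b′ → (a + a′) + (b + b′) ≡ (a + b) + (a′ + b′)
  regroup = solve-∀
  regroup′ : ∀ c d s c′ d′ s′ → (c + d + s) + (c′ + d′ + s′) ≡ (c + c′) + (d + d′) + (s + s′)
  regroup′ = solve-∀

ℕ-identity⇒ℤ : ∀ a b c d t → a + d ≡ b + c + t →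
  + t ≡ ((+ a -ℤ + b) -ℤ + c) +ℤ + d
ℕ-identity⇒ℤ a b c d t e = begin
  + t                                   ≡⟨ cancel (+ b +ℤ + c) (+ t) ⟩
  ((+ b +ℤ + c) +ℤ + t) -ℤ (+ b +ℤ + c) ≡⟨ cong (_-ℤ (+ b +ℤ + c)) (sym e′) ⟩
  (+ a +ℤ + d) -ℤ (+ b +ℤ + c)          ≡⟨ regroup (+ a) (+ b) (+ c) (+ d) ⟩
  ((+ a -ℤ + b) -ℤ + c) +ℤ + d          ∎
  where
  open ≡-Reasoning
  cancel : ∀ (x y : ℤ) → y ≡ (x +ℤ y) -ℤ x
  cancel = ℤ-Solver.solve-∀
  regroup : ∀ (a b c d : ℤ) → (a +ℤ d) -ℤ (b +ℤ c) ≡ ((a -ℤ b) -ℤ c) +ℤ d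
  regroup = ℤ-Solver.solve-∀
  e′ : + a +ℤ + d ≡ (+ b +ℤ + c) +ℤ + t
  e′ = begin
    + a +ℤ + d          ≡⟨ sym (pos-+ a d) ⟩
    + (a + d)           ≡⟨ cong +_ e ⟩
    + (b + c + t)       ≡⟨ pos-+ (b + c) t ⟩
    + (b + c) +ℤ + t    ≡⟨ cong (_+ℤ + t) (pos-+ b c) ⟩
    (+ b +ℤ + c) +ℤ + t ∎

least-witness : {Q : ℕ → Set} → (∀ n → Dec (Q n)) → ∀ d → Q d →
  Σ ℕ λ p → (Q p × (∀ q → Q q → p ≤ q)) × p ≤ d
least-witness {Q} Q? d qd = search 0 d refl (λ _ ())
  where
  -- Invariant: no number below n satisfies Q, and n + gas = d.
  search : ∀ n gas → n + gas ≡ d → (∀ q → q < n → ¬ Q q) →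
    Σ ℕ λ p → (Q p × (∀ q → Q q → p ≤ q)) × p ≤ d
  search n gas n+gas≡d below with Q? n
  ... | yes qn = n , (qn , λ q qq → ≮⇒≥ λ q<n → below q q<n qq) , subst (n ≤_) n+gas≡d (m≤m+n n gas)
  search n zero n+0≡d _ | no ¬qn = ⊥-elim (¬qn (subst Q (trans (sym n+0≡d) (+-identityʳ n)) qd))
  search n (suc gas) n+gas≡d below | no ¬qn =
    search (suc n) gas (trans (sym (+-suc n gas)) n+gas≡d) below′
    where
    below′ : ∀ q → q < suc n → ¬ Q q
    below′ q q<1+n with m<1+n⇒m<n∨m≡n q<1+n
    ... | inj₁ q<n = below q q<n
    ... | inj₂ refl = ¬qn

!!-drop : ∀ {A : Set} (xs : List A) a t → drop a xs !! t ≡ xs !! (a + t)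
!!-drop []       zero    t = refl
!!-drop []       (suc a) t = refl
!!-drop (x ∷ xs) zero    t = refl
!!-drop (x ∷ xs) (suc a) t = !!-drop xs a t

!!-take : ∀ {A : Set} (xs : List A) n t → t < n → take n xs !! t ≡ xs !! t
!!-take []       (suc n) t       _         = refl
!!-take (x ∷ xs) (suc n) zero    _         = refl
!!-take (x ∷ xs) (suc n) (suc t) (s≤s t<n) = !!-take xs n t t<n

module _ {A : Set} (_≟_ : DecidableEquality A) where

  ∈-range⁻ : ∀ {s t x} → x ∈ range _≟_ s t → s ≤ x × x < t
  ∈-range⁻ {s} {t} x∈ with y , y∈ , refl ← ∈-map⁻ (_+_ s) x∈ =
    m≤m+n s y , subst (_≤ t) (cong suc (+-comm y s)) (m≤o∸n⇒m+n≤o (suc y) s≤t y<t∸s)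
    where
    y<t∸s : y < t ∸ s
    y<t∸s = ∈-upTo⁻ y∈
    s≤t : s ≤ t
    s≤t = <⇒≤ (m∸n≢0⇒n<m (λ t∸s≡0 → n≮0 (subst (y <_) t∸s≡0 y<t∸s)))

  ∈-range⁺ : ∀ {s t x} → s ≤ x → x < t → x ∈ range _≟_ s t
  ∈-range⁺ {s} s≤x x<t =
    subst (_∈ range _≟_ s _) (m+[n∸m]≡n s≤x) (∈-map⁺ (_+_ s) (∈-upTo⁺ (∸-monoˡ-< x<t s≤x)))

  range-unique : ∀ s t → Unique (range _≟_ s t)
  range-unique s t = Unique.map⁺ (+-cancelˡ-≡ s _ _) (Unique.upTo⁺ (t ∸ s))

  range-empty : ∀ s → range _≟_ s s ≡ []
  range-empty s = cong (map (_+_ s) ∘ upTo) (n∸n≡0 s)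

  range-step : ∀ {s t} → s < t → range _≟_ s t ≡ s ∷ range _≟_ (suc s) t
  range-step {s} {t} s<t = begin
    map (_+_ s) (upTo (t ∸ s))                   ≡⟨ cong (map (_+_ s) ∘ upTo) (+-∸-assoc 1 s<t) ⟩
    (s + 0) ∷ map (_+_ s) (applyUpTo suc n)      ≡⟨ cong₂ _∷_ (+-identityʳ s) shifted ⟩
    s ∷ map (_+_ (suc s)) (upTo n)               ∎
    where
    open ≡-Reasoning
    n : ℕ
    n = t ∸ suc s
    shifted : map (_+_ s) (applyUpTo suc n) ≡ map (_+_ (suc s)) (upTo n)
    shifted = begin
      map (_+_ s) (applyUpTo suc n)       ≡⟨ cong (map (_+_ s)) (sym (map-upTo suc n)) ⟩
      map (_+_ s) (map suc (upTo n))      ≡⟨ sym (map-∘ (upTo n)) ⟩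
      map (_+_ s ∘ suc) (upTo n)          ≡⟨ map-cong (+-suc s) (upTo n) ⟩
      map (_+_ (suc s)) (upTo n)          ∎

  range-split′ : ∀ g {s t} → g + s ≤ t → range _≟_ s t ≡ range _≟_ s (g + s) ++ range _≟_ (g + s) t
  range-split′ zero    {s} {t} _  = cong (_++ range _≟_ s t) (sym (range-empty s))
  range-split′ (suc g) {s} {t} le = begin
    range _≟_ s t                                           ≡⟨ range-step (<-≤-trans s<1+g+s le) ⟩
    s ∷ range _≟_ (suc s) t                                 ≡⟨ cong (s ∷_) (range-split′ g le′) ⟩
    s ∷ (range _≟_ (suc s) (g + suc s) ++ range _≟_ (g + suc s) t)
      ≡⟨ cong (λ u → s ∷ (range _≟_ (suc s) u ++ range _≟_ u t)) (+-suc g s) ⟩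
    s ∷ (range _≟_ (suc s) (suc g + s) ++ range _≟_ (suc g + s) t)
      ≡⟨ cong (_++ range _≟_ (suc g + s) t) (sym (range-step s<1+g+s)) ⟩
    range _≟_ s (suc g + s) ++ range _≟_ (suc g + s) t      ∎
    where
    open ≡-Reasoning
    s<1+g+s : s < suc g + s
    s<1+g+s = s≤s (m≤n+m s g)
    le′ : g + suc s ≤ t
    le′ = subst (_≤ t) (sym (+-suc g s)) le

  range-split : ∀ {s u t} → s ≤ u → u ≤ t → range _≟_ s t ≡ range _≟_ s u ++ range _≟_ u t
  range-split {s} {u} {t} s≤u u≤t =
    subst (λ v → range _≟_ s t ≡ range _≟_ s v ++ range _≟_ v t) (m∸n+n≡m s≤u)
      (range-split′ (u ∸ s) (subst (_≤ t) (sym (m∸n+n≡m s≤u)) u≤t))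

  -- Whether p is a period is decidable: only the positions t < |S| matter.
  isPeriod? : (S : List A) (p : ℕ) → Dec (IsPeriod S p)
  isPeriod? S p = (0 <? p) ×-dec map′ fromAll toAll (all? agrees? (upTo (length S)))
    where
    Agrees : ℕ → Set
    Agrees t = t + p < length S → S !! t ≡ S !! (t + p)
    agrees? : Decidable Agrees
    agrees? t = (t + p <? length S) →-dec maybe-≡-dec _≟_ (S !! t) (S !! (t + p))
    fromAll : All Agrees (upTo (length S)) → ∀ t → Agrees t
    fromAll all t t+p<|S| = All.lookup all (∈-upTo⁺ (≤-<-trans (m≤m+n t p) t+p<|S|)) t+p<|S|
    toAll : (∀ t → Agrees t) → All Agrees (upTo (length S))
    toAll agree = All.tabulate λ {t} _ → agree t

  occurrences⇒period : ∀ T P a d → OccursAt _≟_ T P a → OccursAt _≟_ T P (a + d) →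
    ∀ t → t + d < length P → P !! t ≡ P !! (t + d)
  occurrences⇒period T P a d (_ , P-at-a) (_ , P-at-a+d) t t+d<L = begin
    P !! t                                   ≡⟨ cong (_!! t) (sym P-at-a+d) ⟩
    take L (drop (a + d) T) !! t             ≡⟨ !!-take _ L t (≤-<-trans (m≤m+n t d) t+d<L) ⟩
    drop (a + d) T !! t                      ≡⟨ !!-drop T (a + d) t ⟩
    T !! (a + d + t)                         ≡⟨ cong (T !!_) reassoc ⟩
    T !! (a + (t + d))                       ≡⟨ sym (!!-drop T a (t + d)) ⟩
    drop a T !! (t + d)                      ≡⟨ sym (!!-take _ L (t + d) t+d<L) ⟩
    take L (drop a T) !! (t + d)             ≡⟨ cong (_!! (t + d)) P-at-a ⟩
    P !! (t + d)                             ∎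
    where
    open ≡-Reasoning
    L : ℕ
    L = length P
    reassoc : a + d + t ≡ a + (t + d)
    reassoc = trans (+-assoc a d t) (cong (_+_ a) (+-comm d t))

  close-occurrences⇒highlyPeriodic : ∀ T P {a b} → OccursAt _≟_ T P a → OccursAt _≟_ T P b →
    a < b → 4 * (b ∸ a) ≤ length P → HighlyPeriodic P
  close-occurrences⇒highlyPeriodic T P {a} {b} P-at-a P-at-b a<b 4d≤L =
    let p , per , p≤d = least-witness (isPeriod? P) (b ∸ a) (m<n⇒0<n∸m a<b , agree)
    in  p , per , ≤-trans (*-monoʳ-≤ 4 p≤d) 4d≤L
    where
    agree : ∀ t → t + (b ∸ a) < length P → P !! t ≡ P !! (t + (b ∸ a))
    agree = occurrences⇒period T P a (b ∸ a) P-at-a (subst (OccursAt _≟_ T P) (sym (m+[n∸m]≡n (<⇒≤ a<b))) P-at-b)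

module PerPattern {A : Set} (_≟_ : DecidableEquality A) (T P : List A)
  (i j k l : ℕ) (i≤j : i ≤ j) (j≤k : j ≤ k) (k≤l : k ≤ l) where

  L : ℕ
  L = length P

  occCount : ℕ → ℕ → ℕ
  occCount x y = count (occIn? _≟_ T P x y) (range _≟_ x y)

  Spanning : ℕ → Set
  Spanning a = OccIn _≟_ T P i l a × k < a + L

  spanning? : Decidable Spanning
  spanning? = occIn? _≟_ T P i l ∩? (λ a → k <? a + L)

  spanCount : ℕ
  spanCount = count spanning? (range _≟_ i j)

  startsInF₁ : ℕ → ℕ
  startsInF₁ y = count (occIn? _≟_ T P i y) (range _≟_ i j)

  -- Occurrences in [i,y) either start in F₁ or lie inside [j,y).  (OccIn does
  -- not depend on the left end of the fragment, so the second part is c(j,y).)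
  split-at-j : ∀ {y} → j ≤ y → occCount i y ≡ startsInF₁ y + occCount j y
  split-at-j j≤y = trans (cong (count (occIn? _≟_ T P i _)) (range-split _≟_ i≤j j≤y))
                         (count-++ (occIn? _≟_ T P i _) (range _≟_ i j) (range _≟_ j _))

  split-spanning : startsInF₁ l ≡ spanCount + startsInF₁ k
  split-spanning =
    trans (count-partition (occIn? _≟_ T P i l) (λ a → k <? a + L) (range _≟_ i j))
          (cong (λ xs → spanCount + length xs)
                (filter-≐ _ (occIn? _≟_ T P i k) (endsByK , notSpanning) (range _≟_ i j)))
    where
    endsByK : ∀ {a} → OccIn _≟_ T P i l a × ¬ (k < a + L) → OccIn _≟_ T P i k a
    endsByK ((P-at-a , _) , ¬span) = P-at-a , ≮⇒≥ ¬span
    notSpanning : ∀ {a} → OccIn _≟_ T P i k a → OccIn _≟_ T P i l a × ¬ (k < a + L)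
    notSpanning (P-at-a , a+L≤k) = (P-at-a , ≤-trans a+L≤k k≤l) , ≤⇒≯ a+L≤k

  inclusion-exclusion : occCount i l + occCount j k ≡ occCount i k + occCount j l + spanCount
  inclusion-exclusion = begin
    occCount i l + occCount j k
      ≡⟨ cong (_+ occCount j k) (split-at-j (≤-trans j≤k k≤l)) ⟩
    (startsInF₁ l + occCount j l) + occCount j k
      ≡⟨ cong (λ z → (z + occCount j l) + occCount j k) split-spanning ⟩
    ((spanCount + startsInF₁ k) + occCount j l) + occCount j k
      ≡⟨ regroup spanCount (startsInF₁ k) (occCount j l) (occCount j k) ⟩
    (startsInF₁ k + occCount j k) + occCount j l + spanCount
      ≡⟨ cong (λ z → z + occCount j l + spanCount) (sym (split-at-j j≤k)) ⟩
    occCount i k + occCount j l + spanCount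
      ∎
    where
    open ≡-Reasoning
    regroup : ∀ s x y z → ((s + x) + y) + z ≡ (x + z) + y + s
    regroup = solve-∀

  module Aperiodic (¬hp : ¬ HighlyPeriodic P)
    (|F₁|≡|F₃| : j ∸ i ≡ l ∸ k) (8|F₁|≤|F₂| : 8 * (j ∸ i) ≤ k ∸ j) where

    -- A spanning occurrence starting in F₁ covers F₂, so |P| > 8|F₁|.
    spanning-long : ∀ {a} → a < j → Spanning a → 8 * (j ∸ i) < L
    spanning-long a<j (_ , k<a+L) = ≤-<-trans 8|F₁|≤|F₂|
      (subst (k ∸ j <_) (m+n∸m≡n j L) (∸-monoˡ-< (<-≤-trans k<a+L (+-monoˡ-≤ L (<⇒≤ a<j))) j≤k))

    no-close-occurrences : ∀ {a x y} → a < j → Spanning a →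
      OccursAt _≟_ T P x → OccursAt _≟_ T P y → x < y → y ∸ x < j ∸ i → ⊥
    no-close-occurrences {a} {x} {y} a<j span P-at-x P-at-y x<y close =
      ¬hp (close-occurrences⇒highlyPeriodic _≟_ T P P-at-x P-at-y x<y 4d≤L)
      where
      open ≤-Reasoning
      4d≤L : 4 * (y ∸ x) ≤ L
      4d≤L = <⇒≤ (begin-strict
        4 * (y ∸ x)   ≤⟨ *-monoˡ-≤ (y ∸ x) {4} {8} (s≤s (s≤s (s≤s (s≤s z≤n)))) ⟩
        8 * (y ∸ x)   ≤⟨ *-monoʳ-≤ 8 (<⇒≤ close) ⟩
        8 * (j ∸ i)   <⟨ spanning-long a<j span ⟩
        L             ∎)

    -- Two spanning occurrences starting in F₁ are less than |F₁| apart, so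
    -- at most one exists.
    spanning-apart : ∀ {x y} → x < y → x ∈ range _≟_ i j → y ∈ range _≟_ i j →
      Spanning x → Spanning y → ⊥
    spanning-apart x<y x∈ y∈ span-x span-y =
      let i≤x , x<j = ∈-range⁻ _≟_ x∈
          _   , y<j = ∈-range⁻ _≟_ y∈
      in  no-close-occurrences x<j span-x (proj₁ (proj₁ span-x)) (proj₁ (proj₁ span-y)) x<y
            (window-distance i≤x (<⇒≤ x<y) y<j)

    spanning-unique : ∀ {x y} → x ∈ range _≟_ i j → y ∈ range _≟_ i j →
      Spanning x → Spanning y → x ≡ y
    spanning-unique {x} {y} x∈ y∈ span-x span-y with <-cmp x y
    ... | tri< x<y _ _ = ⊥-elim (spanning-apart x<y x∈ y∈ span-x span-y)
    ... | tri≈ _ x≡y _ = x≡y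
    ... | tri> _ _ y<x = ⊥-elim (spanning-apart y<x y∈ x∈ span-y span-x)

    -- A spanning occurrence starting in F₁ excludes any occurrence inside F₁F₂:
    -- such an occurrence would start before it, inside F₁.
    spanning⇒¬occurs-F₁F₂ : ∀ {a} → a < j → Spanning a → ¬ OccursInFrag _≟_ T P i k
    spanning⇒¬occurs-F₁F₂ {a} a<j span@((P-at-a , _) , k<a+L) occ =
      let b , b∈ , P-at-b , b+L≤k = find occ
          i≤b , _ = ∈-range⁻ _≟_ b∈
          b<a = +-cancelʳ-< L b a (≤-<-trans b+L≤k k<a+L)
      in  no-close-occurrences a<j span P-at-b P-at-a b<a (window-distance i≤b (<⇒≤ b<a) a<j)

    -- … and any occurrence inside F₂F₃: it would start after it, by less than |F₃| = |F₁|.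
    spanning⇒¬occurs-F₂F₃ : ∀ {a} → a < j → Spanning a → ¬ OccursInFrag _≟_ T P j l
    spanning⇒¬occurs-F₂F₃ {a} a<j span@((P-at-a , _) , k<a+L) occ =
      let b , b∈ , P-at-b , b+L≤l = find occ
          j≤b , _ = ∈-range⁻ _≟_ b∈
          a<b = <-≤-trans a<j j≤b
      in  no-close-occurrences a<j span P-at-a P-at-b a<b
            (subst (b ∸ a <_) (sym |F₁|≡|F₃|) (gap-bound L (<⇒≤ a<b) k<a+L b+L≤l))

    startEnd⇒threeFrag : StartEnd _≟_ T P i j k l → ThreeFrag _≟_ T i j k l P
    startEnd⇒threeFrag startEnd =
      let a , a∈ , span = find startEnd
          _ , a<j = ∈-range⁻ _≟_ a∈
      in  startEnd , spanning⇒¬occurs-F₁F₂ a<j span , spanning⇒¬occurs-F₂F₃ a<j span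

    spanCount≡threeFragCount : spanCount ≡ count (threeFrag? _≟_ T i j k l) [ P ]
    spanCount≡threeFragCount with threeFrag? _≟_ T i j k l P
    ... | yes threeFrag@(startEnd , _) =
      trans (count-single spanning? (range-unique _≟_ i j) spanning-unique startEnd)
            (sym (cong length (filter-accept (threeFrag? _≟_ T i j k l) threeFrag)))
    ... | no ¬threeFrag =
      trans (cong length (filter-none spanning? (¬Any⇒All¬ _ (¬threeFrag ∘ startEnd⇒threeFrag))))
            (sym (cong length (filter-reject (threeFrag? _≟_ T i j k l) ¬threeFrag)))

    pattern-identity : occCount i l + occCount j k ≡
      occCount i k + occCount j l + count (threeFrag? _≟_ T i j k l) [ P ]
    pattern-identity = trans inclusion-exclusion (cong (_+_ (occCount i k + occCount j l)) spanCount≡threeFragCount)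

dictionary-identity : {A : Set} (_≟_ : DecidableEquality A) (T : List A) (i j k l : ℕ) →
  i ≤ j → j ≤ k → k ≤ l → j ∸ i ≡ l ∸ k → 8 * (j ∸ i) ≤ k ∸ j →
  ∀ D → All (λ P → ¬ HighlyPeriodic P) D →
  Count _≟_ D T i l + Count _≟_ D T j k ≡
    Count _≟_ D T i k + Count _≟_ D T j l + ThreeFragmentsCounting _≟_ D T i j k l
dictionary-identity _≟_ T i j k l i≤j j≤k k≤l |F₁|≡|F₃| 8|F₁|≤|F₂| [] [] = refl
dictionary-identity _≟_ T i j k l i≤j j≤k k≤l |F₁|≡|F₃| 8|F₁|≤|F₂| (P ∷ D) (¬hp ∷ ¬hps) = begin
  (occCount i l + C i l) + (occCount j k + C j k)
    ≡⟨ add-identities (occCount i l) (occCount j k) (occCount i k) (occCount j l) (count three? [ P ])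
                      (C i l) (C j k) (C i k) (C j l) (count three? D)
         (Aperiodic.pattern-identity ¬hp |F₁|≡|F₃| 8|F₁|≤|F₂|)
         (dictionary-identity _≟_ T i j k l i≤j j≤k k≤l |F₁|≡|F₃| 8|F₁|≤|F₂| D ¬hps) ⟩
  (occCount i k + C i k) + (occCount j l + C j l) + (count three? [ P ] + count three? D)
    ≡⟨ cong (_+_ ((occCount i k + C i k) + (occCount j l + C j l))) (sym (count-++ three? [ P ] D)) ⟩
  (occCount i k + C i k) + (occCount j l + C j l) + count three? (P ∷ D)
    ∎
  where
  open PerPattern _≟_ T P i j k l i≤j j≤k k≤l
  open ≡-Reasoning
  C : ℕ → ℕ → ℕ
  C x y = Count _≟_ D T x y
  three? : Decidable (ThreeFrag _≟_ T i j k l)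
  three? = threeFrag? _≟_ T i j k l

-- The statement.
lemma4p2 : {A : Set} (_≟_ : DecidableEquality A) (T : List A) (D : List (List A)) →
    Unique D →
    All (λ P → P ≢ []) D →
    All (λ P → ¬ HighlyPeriodic P) D →
    (i j k l : ℕ) → i ≤ j → j ≤ k → k ≤ l → l ≤ length T →
    j ∸ i ≡ l ∸ k →
    8 * (j ∸ i) ≤ k ∸ j →
    + ThreeFragmentsCounting _≟_ D T i j k l
    ≡ ((+ Count _≟_ D T i l -ℤ + Count _≟_ D T i k) -ℤ + Count _≟_ D T j l) +ℤ + Count _≟_ D T j k
lemma4p2 _≟_ T D _ _ ¬hps i j k l i≤j j≤k k≤l _ |F₁|≡|F₃| 8|F₁|≤|F₂| =
  ℕ-identity⇒ℤ (Count _≟_ D T i l) (Count _≟_ D T i k) (Count _≟_ D T j l) (Count _≟_ D T j k)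
    (ThreeFragmentsCounting _≟_ D T i j k l)
    (dictionary-identity _≟_ T i j k l i≤j j≤k k≤l |F₁|≡|F₃| 8|F₁|≤|F₂| D ¬hps)
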